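{- Let $n\geq 0$, let $\alpha\in\{U,\ UU,\ UD,\ UF,\ DU,\ FU\}$, and let $L$ be a Łukasiewicz path of length $n$. Then there exists a Motzkin path $M$ of length $n$ such that $M$ and $L$ are $\alpha$-equivalent.
   Context: A lattice path of length $n$ is a sequence of $n$ steps from $S=\{(1,i): i\in\mathbb{Z}\}$ starting at $(0,0)$, ending at $(n,0)$ and never going below the $x$-axis. Write $D=(1,-1)$, $F=(1,0)$, $U=U_1=(1,1)$ and $U_i=(1,i)$ for $i\geq 2$. A Łukasiewicz path is a lattice path whose steps lie in $\{(1,i): i\geq -1\}$; a Motzkin path is a lattice path whose steps lie in $\{U,F,D\}$ (so every Motzkin path is a Łukasiewicz path). The steps of a path of length $n$ are numbered $1,\dots,n$ from left to right. A pattern of length one (resp. two) is a single step (resp. a word of two consecutive steps); an occurrence of a pattern in a path is at position $i$ if its first step is the $i$-th step of the path. For a pattern $\alpha$, two paths of the same length are $\alpha$-equivalent if the sets of positions of the occurrences of $\alpha$ in them are identical. -}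

module Defs where

open import Data.Nat using (ℕ; zero; suc)
open import Data.Integer using (ℤ; +_; -[1+_]; _+_; _≤_; 0ℤ; 1ℤ; -1ℤ)
open import Data.List using (List; []; _∷_; length)
open import Data.List.Relation.Unary.All using (All)
open import Data.Product using (_×_)
open import Data.Sum using (_⊎_)
open import Relation.Binary.PropositionalEquality using (_≡_)
open import Function.Bundles using (_⇔_)

-- A step (1,i) is represented by its vertical component i : ℤ.
-- A path is the list of its steps, read from left to right.
Step : Set
Step = ℤ

Path : Set
Path = List Step

D F U : Step
D = -1ℤ
F = 0ℤ
U = 1ℤ

data FromHeight : ℤ → Path → Set where
  end  : FromHeight 0ℤ []
  step : ∀ {h s p} → 0ℤ ≤ h + s → FromHeight (h + s) p → FromHeight h (s ∷ p)

LatticePath : Path → Set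
LatticePath p = FromHeight 0ℤ p

LukStep : Step → Set
LukStep s = -1ℤ ≤ s

IsŁukasiewicz : Path → Set
IsŁukasiewicz p = LatticePath p × All LukStep p

MotzStep : Step → Set
MotzStep s = s ≡ U ⊎ (s ≡ F ⊎ s ≡ D)

IsMotzkin : Path → Set
IsMotzkin p = LatticePath p × All MotzStep p

data Pat : Set where
  pU pUU pUD pUF pDU pFU : Pat

word : Pat → List Step
word pU  = U ∷ []
word pUU = U ∷ U ∷ []
word pUD = U ∷ D ∷ []
word pUF = U ∷ F ∷ []
word pDU = D ∷ U ∷ []
word pFU = F ∷ U ∷ []

data Prefix : List Step → Path → Set where
  []  : ∀ {p} → Prefix [] p
  _∷_ : ∀ s {w p} → Prefix w p → Prefix (s ∷ w) (s ∷ p)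

-- OccursAt w p i : an occurrence of w in p whose first step is the i-th step
-- of p (positions numbered from 1).
data OccursAt (w : List Step) : Path → ℕ → Set where
  here  : ∀ {p} → Prefix w p → OccursAt w p 1
  there : ∀ {s p i} → OccursAt w p i → OccursAt w (s ∷ p) (suc i)

Equiv : Pat → Path → Path → Set
Equiv α p q = ∀ (i : ℕ) → OccursAt (word α) p i ⇔ OccursAt (word α) q i

-- Read the Łukasiewicz path L as a walk through heights h and build M from left to right at
-- a height m ≤ h, so that M reaches the axis when L does.  For U, UU, UD, UF and FU only a few
-- steps of L must be reproduced: its U's, together with the step after each U for UD and UF
-- (whether it is D, resp. F), and for FU its F's and the U's right after them.  Those steps are
-- kept, and every other step of M descends greedily (D, or F on the axis): a kept step never
-- rises higher than the step of L it copies, and a descent is never U, so no occurrence is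
-- created or lost.  For DU every up-step of L becomes U, a D followed by a large up-step becomes
-- F, and M descends lazily, only when m = h; then M is on the axis only when L is, so it can
-- always take the D of an occurrence of DU.

module Submission where

open import Defs
open import Data.Nat using (ℕ)
open import Data.List using (length)
open import Data.Product using (Σ; _×_)
open import Relation.Binary.PropositionalEquality using (_≡_)

open import Data.Bool using (Bool; true; false; _∧_; T)
open import Data.Empty using (⊥-elim)
open import Data.Integer using (+_; -[1+_]; _≟_; -≤-; +≤+)
open import Data.List using (List; []; _∷_; map)
open import Data.List.Properties using (∷-injectiveˡ; ∷-injectiveʳ)
open import Data.List.Relation.Unary.All using (All; []; _∷_)
open import Data.Nat using (zero; suc; pred; _+_; _≤_; z≤n; s≤s)
open import Data.Nat.Properties
  using (≤-refl; ≤-trans; pred[n]≤n; pred-mono-≤; m≤n⇒m≤o+n; m≤n⇒m<n∨m≡n; +-identityʳ; +-comm)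
open import Data.Product using (_,_)
open import Data.Sum using (inj₁; inj₂)
open import Function.Bundles using (mk⇔)
open import Relation.Nullary using (does; yes; no)
open import Relation.Binary.PropositionalEquality using (refl; sym; trans; cong; cong₂; subst)

startsWith : List Step → Path → Bool
startsWith []      _       = true
startsWith (_ ∷ _) []      = false
startsWith (s ∷ w) (x ∷ p) = does (s ≟ x) ∧ startsWith w p

startsWith-sound : ∀ w p → T (startsWith w p) → Prefix w p
startsWith-sound []      _       _ = []
startsWith-sound (s ∷ w) (x ∷ p) t with s ≟ x
... | yes refl = s ∷ startsWith-sound w p t

startsWith-complete : ∀ {w p} → Prefix w p → T (startsWith w p)
startsWith-complete []                = _
startsWith-complete (s ∷ w⊑p) with s ≟ s
... | yes _ = startsWith-complete w⊑p
... | no s≢s = ⊥-elim (s≢s refl)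

data Agree (w : List Step) : Path → Path → Set where
  []  : Agree w [] []
  _∷_ : ∀ {x y M L} → startsWith w (x ∷ M) ≡ startsWith w (y ∷ L) →
        Agree w M L → Agree w (x ∷ M) (y ∷ L)

Agree-sym : ∀ {w M L} → Agree w M L → Agree w L M
Agree-sym []       = []
Agree-sym (e ∷ ag) = sym e ∷ Agree-sym ag

Agree⇒length : ∀ {w M L} → Agree w M L → length M ≡ length L
Agree⇒length []       = refl
Agree⇒length (_ ∷ ag) = cong suc (Agree⇒length ag)

Agree⇒OccursAt : ∀ {w M L i} → Agree w M L → OccursAt w M i → OccursAt w L i
Agree⇒OccursAt []                      occ         = occ
Agree⇒OccursAt {w} {L = y ∷ L} (e ∷ _) (here w⊑M)  =
  here (startsWith-sound w (y ∷ L) (subst T e (startsWith-complete w⊑M)))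
Agree⇒OccursAt (_ ∷ ag)                (there occ) = there (Agree⇒OccursAt ag occ)

Agree⇒Equiv : ∀ {α M L} → Agree (word α) M L → Equiv α M L
Agree⇒Equiv ag i = mk⇔ (Agree⇒OccursAt ag) (Agree⇒OccursAt (Agree-sym ag))

data Łuk : ℕ → Path → Set where
  []    : Łuk 0 []
  down  : ∀ {h L} → Łuk h L → Łuk (suc h) (D ∷ L)
  level : ∀ {h L} → Łuk h L → Łuk h (F ∷ L)
  rise  : ∀ {h L} k → Łuk (suc k + h) L → Łuk h (+ suc k ∷ L)

data Motz : ℕ → Path → Set where
  []   : Motz 0 []
  up   : ∀ {m M} → Motz (suc m) M → Motz m (U ∷ M)
  flat : ∀ {m M} → Motz m M → Motz m (F ∷ M)
  down : ∀ {m M} → Motz m M → Motz (suc m) (D ∷ M)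

reheight : ∀ {h h′ L} → h ≡ h′ → FromHeight (+ h) L → FromHeight (+ h′) L
reheight refl p = p

FromHeight⇒Łuk : ∀ {h L} → FromHeight (+ h) L → All LukStep L → Łuk h L
FromHeight⇒Łuk end [] = []
FromHeight⇒Łuk {zero}  (step {s = -[1+ zero ]} () _) _
FromHeight⇒Łuk {suc h} (step {s = -[1+ zero ]} _ lattice) (_ ∷ steps) =
  down (FromHeight⇒Łuk lattice steps)
FromHeight⇒Łuk (step {s = -[1+ suc _ ]} _ _) (-≤- () ∷ _)
FromHeight⇒Łuk {h} (step {s = + zero} _ lattice) (_ ∷ steps) =
  level (FromHeight⇒Łuk (reheight (+-identityʳ h) lattice) steps)
FromHeight⇒Łuk {h} (step {s = + suc k} _ lattice) (_ ∷ steps) =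
  rise k (FromHeight⇒Łuk (reheight (+-comm h (suc k)) lattice) steps)

Motz⇒FromHeight : ∀ {m M} → Motz m M → FromHeight (+ m) M
Motz⇒FromHeight []            = end
Motz⇒FromHeight (up {m} mo)   = step (+≤+ z≤n) (reheight (+-comm 1 m) (Motz⇒FromHeight mo))
Motz⇒FromHeight (flat {m} mo) =
  step (+≤+ z≤n) (reheight (sym (+-identityʳ m)) (Motz⇒FromHeight mo))
Motz⇒FromHeight (down mo)     = step (+≤+ z≤n) (Motz⇒FromHeight mo)

Motz⇒MotzSteps : ∀ {m M} → Motz m M → All MotzStep M
Motz⇒MotzSteps []        = []
Motz⇒MotzSteps (up mo)   = inj₁ refl ∷ Motz⇒MotzSteps mo
Motz⇒MotzSteps (flat mo) = inj₂ (inj₁ refl) ∷ Motz⇒MotzSteps mo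
Motz⇒MotzSteps (down mo) = inj₂ (inj₂ refl) ∷ Motz⇒MotzSteps mo

data Marking : Path → Set where
  []   : Marking []
  up   : ∀ {k L} → Marking L → Marking (+ suc k ∷ L)
  flat : ∀ {n L} → Marking L → Marking (+ n ∷ L)
  free : ∀ {s L} → Marking L → Marking (s ∷ L)

descent : ℕ → Step
descent zero    = F
descent (suc _) = D

realise : ∀ {L} → ℕ → Marking L → Path
realise m []       = []
realise m (up μ)   = U ∷ realise (suc m) μ
realise m (flat μ) = F ∷ realise m μ
realise m (free μ) = descent m ∷ realise (pred m) μ

descent-Motz : ∀ m {M} → Motz (pred m) M → Motz m (descent m ∷ M)
descent-Motz zero    mo = flat mo
descent-Motz (suc m) mo = down mo

realise-Motz : ∀ {m h L} → m ≤ h → Łuk h L → (μ : Marking L) → Motz m (realise m μ)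
realise-Motz z≤n []          []       = []
realise-Motz m≤h (rise k l)  (up μ)   = up (realise-Motz (s≤s (m≤n⇒m≤o+n k m≤h)) l μ)
realise-Motz m≤h (rise k l)  (flat μ) = flat (realise-Motz (m≤n⇒m≤o+n (suc k) m≤h) l μ)
realise-Motz m≤h (level l)   (flat μ) = flat (realise-Motz m≤h l μ)
realise-Motz m≤h (down l)    (free μ) = descent-Motz _ (realise-Motz (pred-mono-≤ m≤h) l μ)
realise-Motz m≤h (level l)   (free μ) = descent-Motz _ (realise-Motz (≤-trans pred[n]≤n m≤h) l μ)
realise-Motz m≤h (rise k l)  (free μ) =
  descent-Motz _ (realise-Motz (m≤n⇒m≤o+n (suc k) (≤-trans pred[n]≤n m≤h)) l μ)

U≟descent : ∀ m → does (U ≟ descent m) ≡ false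
U≟descent zero    = refl
U≟descent (suc m) = refl

U≟descent-∧ : ∀ m {b} → does (U ≟ descent m) ∧ b ≡ false
U≟descent-∧ m = cong (_∧ _) (U≟descent m)

Us : Path → List Bool
Us = map (λ s → does (U ≟ s))

startsWith-Us : ∀ {w p q} → All (_≡ U) w → Us p ≡ Us q → startsWith w p ≡ startsWith w q
startsWith-Us []                         _  = refl
startsWith-Us {p = []}    {[]}    (_ ∷ _) _  = refl
startsWith-Us {p = _ ∷ _} {_ ∷ _} (refl ∷ allU) e =
  cong₂ _∧_ (∷-injectiveˡ e) (startsWith-Us allU (∷-injectiveʳ e))

Agree-Us : ∀ {w M L} → All (_≡ U) w → Us M ≡ Us L → Agree w M L
Agree-Us {M = []}    {[]}    _    _ = []
Agree-Us {M = _ ∷ _} {_ ∷ _} allU e = startsWith-Us allU e ∷ Agree-Us allU (∷-injectiveʳ e)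

markU : ∀ {h L} → Łuk h L → Marking L
markU []               = []
markU (down l)         = free (markU l)
markU (level l)        = free (markU l)
markU (rise zero l)    = up (markU l)
markU (rise (suc k) l) = free (markU l)

Us-markU : ∀ m {h L} (l : Łuk h L) → Us (realise m (markU l)) ≡ Us L
Us-markU m []               = refl
Us-markU m (down l)         = cong₂ _∷_ (U≟descent m) (Us-markU (pred m) l)
Us-markU m (level l)        = cong₂ _∷_ (U≟descent m) (Us-markU (pred m) l)
Us-markU m (rise zero l)    = cong (true ∷_) (Us-markU (suc m) l)
Us-markU m (rise (suc k) l) = cong₂ _∷_ (U≟descent m) (Us-markU (pred m) l)

mutual
  markUD : ∀ {h L} → Łuk h L → Marking L
  markUD []               = []
  markUD (down l)         = free (markUD l)
  markUD (level l)        = free (markUD l)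
  markUD (rise zero l)    = up (markUD-afterU l)
  markUD (rise (suc k) l) = free (markUD l)

  markUD-afterU : ∀ {h L} → Łuk h L → Marking L
  markUD-afterU []               = []
  markUD-afterU (down l)         = free (markUD l)
  markUD-afterU (level l)        = flat (markUD l)
  markUD-afterU (rise zero l)    = up (markUD-afterU l)
  markUD-afterU (rise (suc k) l) = flat (markUD l)

mutual
  Agree-markUD : ∀ m {h L} (l : Łuk h L) → Agree (word pUD) (realise m (markUD l)) L
  Agree-markUD m []               = []
  Agree-markUD m (down l)         = U≟descent-∧ m ∷ Agree-markUD (pred m) l
  Agree-markUD m (level l)        = U≟descent-∧ m ∷ Agree-markUD (pred m) l
  Agree-markUD m (rise zero l)    = Agree-markUD-afterU m l
  Agree-markUD m (rise (suc k) l) = U≟descent-∧ m ∷ Agree-markUD (pred m) l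

  Agree-markUD-afterU : ∀ m {h L} (l : Łuk h L) →
    Agree (word pUD) (U ∷ realise (suc m) (markUD-afterU l)) (U ∷ L)
  Agree-markUD-afterU m []               = refl ∷ []
  Agree-markUD-afterU m (down l)         = refl ∷ refl ∷ Agree-markUD m l
  Agree-markUD-afterU m (level l)        = refl ∷ refl ∷ Agree-markUD (suc m) l
  Agree-markUD-afterU m (rise zero l)    = refl ∷ Agree-markUD-afterU (suc m) l
  Agree-markUD-afterU m (rise (suc k) l) = refl ∷ refl ∷ Agree-markUD (suc m) l

mutual
  markUF : ∀ {h L} → Łuk h L → Marking L
  markUF []               = []
  markUF (down l)         = free (markUF l)
  markUF (level l)        = free (markUF l)
  markUF (rise zero l)    = up (markUF-afterU l)
  markUF (rise (suc k) l) = free (markUF l)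

  markUF-afterU : ∀ {h L} → Łuk h L → Marking L
  markUF-afterU []               = []
  markUF-afterU (down l)         = free (markUF l)
  markUF-afterU (level l)        = flat (markUF l)
  markUF-afterU (rise zero l)    = up (markUF-afterU l)
  markUF-afterU (rise (suc k) l) = free (markUF l)

mutual
  Agree-markUF : ∀ m {h L} (l : Łuk h L) → Agree (word pUF) (realise m (markUF l)) L
  Agree-markUF m []               = []
  Agree-markUF m (down l)         = U≟descent-∧ m ∷ Agree-markUF (pred m) l
  Agree-markUF m (level l)        = U≟descent-∧ m ∷ Agree-markUF (pred m) l
  Agree-markUF m (rise zero l)    = Agree-markUF-afterU m l
  Agree-markUF m (rise (suc k) l) = U≟descent-∧ m ∷ Agree-markUF (pred m) l

  Agree-markUF-afterU : ∀ m {h L} (l : Łuk h L) →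
    Agree (word pUF) (U ∷ realise (suc m) (markUF-afterU l)) (U ∷ L)
  Agree-markUF-afterU m []               = refl ∷ []
  Agree-markUF-afterU m (down l)         = refl ∷ refl ∷ Agree-markUF m l
  Agree-markUF-afterU m (level l)        = refl ∷ refl ∷ Agree-markUF (suc m) l
  Agree-markUF-afterU m (rise zero l)    = refl ∷ Agree-markUF-afterU (suc m) l
  Agree-markUF-afterU m (rise (suc k) l) = refl ∷ refl ∷ Agree-markUF m l

mutual
  markFU : ∀ {h L} → Łuk h L → Marking L
  markFU []         = []
  markFU (down l)   = free (markFU l)
  markFU (level l)  = flat (markFU-afterF l)
  markFU (rise k l) = free (markFU l)

  markFU-afterF : ∀ {h L} → Łuk h L → Marking L
  markFU-afterF []               = []
  markFU-afterF (down l)         = free (markFU l)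
  markFU-afterF (level l)        = flat (markFU-afterF l)
  markFU-afterF (rise zero l)    = up (markFU l)
  markFU-afterF (rise (suc k) l) = free (markFU l)

startsWithU-markFU : ∀ m {h L} (l : Łuk h L) → startsWith (U ∷ []) (realise m (markFU l)) ≡ false
startsWithU-markFU m []         = refl
startsWithU-markFU m (down l)   = U≟descent-∧ m
startsWithU-markFU m (level l)  = refl
startsWithU-markFU m (rise k l) = U≟descent-∧ m

startsWithFU-descent : ∀ m {h L} (l : Łuk h L) →
  startsWith (word pFU) (descent m ∷ realise (pred m) (markFU l)) ≡ false
startsWithFU-descent zero    l = startsWithU-markFU zero l
startsWithFU-descent (suc m) l = refl

mutual
  Agree-markFU : ∀ m {h L} (l : Łuk h L) → Agree (word pFU) (realise m (markFU l)) L
  Agree-markFU m []         = []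
  Agree-markFU m (down l)   = startsWithFU-descent m l ∷ Agree-markFU (pred m) l
  Agree-markFU m (level l)  = Agree-markFU-afterF m l
  Agree-markFU m (rise k l) = startsWithFU-descent m l ∷ Agree-markFU (pred m) l

  Agree-markFU-afterF : ∀ m {h L} (l : Łuk h L) →
    Agree (word pFU) (F ∷ realise m (markFU-afterF l)) (F ∷ L)
  Agree-markFU-afterF m []                  = refl ∷ []
  Agree-markFU-afterF m l@(down _)          = U≟descent-∧ m ∷ Agree-markFU m l
  Agree-markFU-afterF m (level l)           = refl ∷ Agree-markFU-afterF m l
  Agree-markFU-afterF m (rise zero l)       = refl ∷ refl ∷ Agree-markFU (suc m) l
  Agree-markFU-afterF m l@(rise (suc _) _)  = U≟descent-∧ m ∷ Agree-markFU m l

data Tracks : ℕ → ℕ → Set where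
  ground : Tracks 0 0
  above  : ∀ {m h} → m ≤ h → Tracks (suc m) (suc h)

Tracks-refl : ∀ h → Tracks h h
Tracks-refl zero    = ground
Tracks-refl (suc h) = above ≤-refl

Tracks-rise : ∀ k {m h} → Tracks m h → Tracks (suc m) (suc k + h)
Tracks-rise k ground      = above z≤n
Tracks-rise k (above m≤h) = above (m≤n⇒m≤o+n k (s≤s m≤h))

rising : Path → Bool
rising (+ suc _ ∷ _) = true
rising _             = false

DUWitness : ℕ → Path → Set
DUWitness m L =
  Σ Path λ M → Motz m M × Agree (word pDU) M L × (startsWith (U ∷ []) M ≡ rising L)

mutual
  witnessDU : ∀ {m h L} → Tracks m h → Łuk h L → DUWitness m L
  witnessDU ground [] = [] , [] , [] , refl
  witnessDU t (level l) with witnessDU t l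
  ... | M , mo , ag , _ = F ∷ M , flat mo , refl ∷ ag , refl
  witnessDU t (rise k l) with witnessDU (Tracks-rise k t) l
  ... | M , mo , ag , _ = U ∷ M , up mo , refl ∷ ag , refl
  witnessDU (above m≤h) (down (rise zero l)) with witnessDU (above m≤h) l
  ... | M , mo , ag , _ = D ∷ U ∷ M , down (up mo) , refl ∷ refl ∷ ag , refl
  witnessDU (above m≤h) (down (rise (suc k) l))
    with witnessDU (above (s≤s (m≤n⇒m≤o+n k m≤h))) l
  ... | M , mo , ag , _ = F ∷ U ∷ M , flat (up mo) , refl ∷ refl ∷ ag , refl
  witnessDU (above m≤h) (down l@[])        = lazyDown m≤h refl refl l
  witnessDU (above m≤h) (down l@(down _))  = lazyDown m≤h refl refl l
  witnessDU (above m≤h) (down l@(level _)) = lazyDown m≤h refl refl l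

  lazyDown : ∀ {m h L} → m ≤ h → rising L ≡ false → startsWith (U ∷ []) L ≡ false →
    Łuk h L → DUWitness (suc m) (D ∷ L)
  lazyDown m≤h notRising notU l with m≤n⇒m<n∨m≡n m≤h
  ... | inj₁ (s≤s m<h) with witnessDU (above m<h) l
  ...   | M , mo , ag , _ = F ∷ M , flat mo , sym notU ∷ ag , refl
  lazyDown m≤h notRising notU l | inj₂ refl with witnessDU (Tracks-refl _) l
  ...   | M , mo , ag , M-U =
          D ∷ M , down mo , trans M-U (trans notRising (sym notU)) ∷ ag , refl

Witness : List Step → Path → Set
Witness w L = Σ Path λ M → Motz 0 M × Agree w M L

greedy : ∀ {w L} (l : Łuk 0 L) (μ : Marking L) → Agree w (realise 0 μ) L → Witness w L
greedy l μ ag = realise 0 μ , realise-Motz z≤n l μ , ag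

witness : ∀ α {L} → Łuk 0 L → Witness (word α) L
witness pU  l = greedy l (markU l) (Agree-Us (refl ∷ []) (Us-markU 0 l))
witness pUU l = greedy l (markU l) (Agree-Us (refl ∷ refl ∷ []) (Us-markU 0 l))
witness pUD l = greedy l (markUD l) (Agree-markUD 0 l)
witness pUF l = greedy l (markUF l) (Agree-markUF 0 l)
witness pFU l = greedy l (markFU l) (Agree-markFU 0 l)
witness pDU l with witnessDU ground l
... | M , mo , ag , _ = M , mo , ag

lemma1 : (n : ℕ) (α : Pat) (L : Path) → IsŁukasiewicz L → length L ≡ n →
    Σ Path (λ M → IsMotzkin M × length M ≡ n × Equiv α M L)
lemma1 _ α L (lattice , steps) refl with witness α (FromHeight⇒Łuk lattice steps)
... | M , mo , ag =
  M , (Motz⇒FromHeight mo , Motz⇒MotzSteps mo) , Agree⇒length ag , Agree⇒Equiv ag
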